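{- Let $n\ge m\ge 1$ and let the edges of $K_{m,n}$ be colored with two colors. Then the total number of alternating paths of length $3$ is at most $m^2n^2/4$, and the total number of alternating paths of length $4$ whose two endpoints both lie in the class of size $n$ is at most $m^2n^3/16$.
   Context: $K_{m,n}$ denotes the complete bipartite graph with vertex classes of sizes $m$ and $n$. A path is alternating if any two adjacent edges of it have different colors; the length of a path is its number of edges. -}

module Defs where

open import Data.Nat using (ℕ; zero; suc; _+_; _<_)
open import Data.Nat.Properties using (_<?_)
open import Data.Bool using (Bool; if_then_else_)
import Data.Bool.Properties as B
open import Data.Fin using (Fin; zero; suc; toℕ)
open import Data.Fin.Properties using (_≟_)
open import Data.Product using (_×_)
open import Relation.Binary.PropositionalEquality using (_≢_)
open import Relation.Nullary using (Dec; does; ¬?)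
open import Relation.Nullary.Decidable using (_×-dec_)

Coloring : ℕ → ℕ → Set
Coloring m n = Fin m → Fin n → Bool

sumFin : ∀ k → (Fin k → ℕ) → ℕ
sumFin zero    f = 0
sumFin (suc k) f = f zero + sumFin k (λ i → f (suc i))

𝟙 : {P : Set} → Dec P → ℕ
𝟙 d = if does d then 1 else 0

-- A path of length 3 in K_{m,n} has one endpoint in each class, so it is
-- a1 - b1 - a2 - b2 with a1 ≠ a2, b1 ≠ b2; writing it starting from its
-- A-endpoint gives a unique representative of each (undirected) path.
AltPath3 : ∀ {m n} → Coloring m n → Fin m → Fin n → Fin m → Fin n → Set
AltPath3 c a1 b1 a2 b2 =
  a1 ≢ a2 × b1 ≢ b2 × c a1 b1 ≢ c a2 b1 × c a2 b1 ≢ c a2 b2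

altPath3? : ∀ {m n} (c : Coloring m n) a1 b1 a2 b2 → Dec (AltPath3 c a1 b1 a2 b2)
altPath3? c a1 b1 a2 b2 =
  ¬? (a1 ≟ a2) ×-dec ¬? (b1 ≟ b2) ×-dec ¬? (c a1 b1 B.≟ c a2 b1) ×-dec ¬? (c a2 b1 B.≟ c a2 b2)

numAlt3 : ∀ {m n} → Coloring m n → ℕ
numAlt3 {m} {n} c =
  sumFin m λ a1 → sumFin n λ b1 → sumFin m λ a2 → sumFin n λ b2 →
    𝟙 (altPath3? c a1 b1 a2 b2)

-- A path of length 4 with both endpoints in B is b1 - a1 - b2 - a2 - b3 with
-- b1, b2, b3 distinct and a1 ≠ a2.  Each undirected path has exactly two such
-- vertex sequences (it and its reverse); we count the one with toℕ b1 < toℕ b3.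
AltPath4 : ∀ {m n} → Coloring m n → Fin n → Fin m → Fin n → Fin m → Fin n → Set
AltPath4 c b1 a1 b2 a2 b3 =
  toℕ b1 < toℕ b3 × b1 ≢ b2 × b2 ≢ b3 × a1 ≢ a2 ×
  c a1 b1 ≢ c a1 b2 × c a1 b2 ≢ c a2 b2 × c a2 b2 ≢ c a2 b3

altPath4? : ∀ {m n} (c : Coloring m n) b1 a1 b2 a2 b3 → Dec (AltPath4 c b1 a1 b2 a2 b3)
altPath4? c b1 a1 b2 a2 b3 =
  (toℕ b1 <? toℕ b3) ×-dec ¬? (b1 ≟ b2) ×-dec ¬? (b2 ≟ b3) ×-dec ¬? (a1 ≟ a2) ×-dec
  ¬? (c a1 b1 B.≟ c a1 b2) ×-dec ¬? (c a1 b2 B.≟ c a2 b2) ×-dec ¬? (c a2 b2 B.≟ c a2 b3)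

numAlt4B : ∀ {m n} → Coloring m n → ℕ
numAlt4B {m} {n} c =
  sumFin n λ b1 → sumFin m λ a1 → sumFin n λ b2 → sumFin m λ a2 → sumFin n λ b3 →
    𝟙 (altPath4? c b1 a1 b2 a2 b3)

module Submission where

-- Both bounds come from counting colour changes at the vertices.  For an edge ab let oppositeAtA a b
-- and oppositeAtB a b be the numbers of edges at a, resp. at b, whose colour differs from that of ab.
-- Forgetting distinctness, an alternating path a₁b₁a₂b₂ is a middle edge a₂b₁ together with an
-- opposite edge at each of its ends, so there are at most Σ oppositeAtB · oppositeAtA of them.  If the
-- k edges at a vertex split into t and f edges of the two colours, the squares of their opposite
-- counts sum to t·f² + f·t² = tf(t + f) ≤ k³/4; the weighted AM-GM inequality
-- 2mn·xy ≤ n²x² + m²y² turns these row and column bounds into 4 Σ xy ≤ m²n².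
-- A path b₁a₁b₂a₂b₃ is counted once among the walks with b₁ < b₃ and once, reversed, among those with
-- b₃ < b₁, so twice the number of paths is at most the number of alternating walks.  Summing out b₁
-- and b₃, the walks through b₂ weigh Σ oppositeAtA a₁ b₂ · oppositeAtA a₂ b₂ over the pairs a₁, a₂
-- whose edges to b₂ differ in colour; that is 2PN ≤ (P + N)²/2 for the masses P, N of the two colour
-- classes at b₂.  Cauchy-Schwarz (Σₐ y)² ≤ m Σₐ y² and the row bound Σ_b oppositeAtA² ≤ n³/4 finish.

open import Defs
open import Data.Nat using (ℕ; _≤_; _*_; _^_)
open import Data.Product using (_×_)
open import Data.Bool using (Bool; true; false; not)
import Data.Bool.Properties as B
open import Data.Fin using (Fin; zero; suc; toℕ)
open import Data.Nat using (zero; suc; _+_; z≤n; NonZero; >-nonZero)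
open import Data.Nat.Properties
open import Data.Nat.Tactic.RingSolver using (solve-∀)
open import Data.Product using (_,_)
open import Data.Sum using ([_,_]′)
open import Function using (const; flip)
open import Relation.Binary.PropositionalEquality
open import Relation.Nullary using (Dec; yes; no; ¬_; ¬?; contradiction)
open import Relation.Nullary.Decidable using (_×-dec_)
open import Algebra.Properties.Semiring.Sum +-*-semiring
  using (sum; ∑-distrib-+; ∑-comm; *-distribˡ-sum)
open import Algebra.Properties.CommutativeSemigroup *-commutativeSemigroup using (x∙yz≈y∙xz; x∙yz≈z∙yx)

sumFin-syntax : ∀ k → (Fin k → ℕ) → ℕ
sumFin-syntax = sumFin

-- The body of ∑[ i < k ] extends over _+_ and _*_ but not over _≡_ or _≤_.
infix 5 sumFin-syntax
syntax sumFin-syntax k (λ i → e) = ∑[ i < k ] e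

sumFin≡sum : ∀ k (f : Fin k → ℕ) → sumFin k f ≡ sum f
sumFin≡sum zero    f = refl
sumFin≡sum (suc k) f = cong (f zero +_) (sumFin≡sum k (λ i → f (suc i)))

sumFin-cong : ∀ k {f g : Fin k → ℕ} → (∀ i → f i ≡ g i) → sumFin k f ≡ sumFin k g
sumFin-cong zero    f≗g = refl
sumFin-cong (suc k) f≗g = cong₂ _+_ (f≗g zero) (sumFin-cong k (λ i → f≗g (suc i)))

sumFin-mono-≤ : ∀ k {f g : Fin k → ℕ} → (∀ i → f i ≤ g i) → sumFin k f ≤ sumFin k g
sumFin-mono-≤ zero    f≤g = z≤n
sumFin-mono-≤ (suc k) f≤g = +-mono-≤ (f≤g zero) (sumFin-mono-≤ k (λ i → f≤g (suc i)))

sumFin-const : ∀ k x → ∑[ _ < k ] x ≡ k * x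
sumFin-const zero    x = refl
sumFin-const (suc k) x = cong (x +_) (sumFin-const k x)

sumFin-≤-const : ∀ k {x} {f : Fin k → ℕ} → (∀ i → f i ≤ x) → sumFin k f ≤ k * x
sumFin-≤-const k {x} f≤x = ≤-trans (sumFin-mono-≤ k f≤x) (≤-reflexive (sumFin-const k x))

sumFin-+ : ∀ k (f g : Fin k → ℕ) → ∑[ i < k ] f i + g i ≡ sumFin k f + sumFin k g
sumFin-+ k f g = begin
  ∑[ i < k ] f i + g i      ≡⟨ sumFin≡sum k _ ⟩
  sum (λ i → f i + g i)     ≡⟨ ∑-distrib-+ f g ⟩
  sum f + sum g             ≡⟨ cong₂ _+_ (sumFin≡sum k f) (sumFin≡sum k g) ⟨
  sumFin k f + sumFin k g   ∎
  where open ≡-Reasoning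

sumFin-*ˡ : ∀ k x (f : Fin k → ℕ) → ∑[ i < k ] x * f i ≡ x * sumFin k f
sumFin-*ˡ k x f = begin
  ∑[ i < k ] x * f i    ≡⟨ sumFin≡sum k _ ⟩
  sum (λ i → x * f i)   ≡⟨ *-distribˡ-sum x f ⟨
  x * sum f             ≡⟨ cong (x *_) (sumFin≡sum k f) ⟨
  x * sumFin k f        ∎
  where open ≡-Reasoning

sumFin-*ʳ : ∀ k x (f : Fin k → ℕ) → ∑[ i < k ] f i * x ≡ sumFin k f * x
sumFin-*ʳ k x f = begin
  ∑[ i < k ] f i * x   ≡⟨ sumFin-cong k (λ i → *-comm (f i) x) ⟩
  ∑[ i < k ] x * f i   ≡⟨ sumFin-*ˡ k x f ⟩
  x * sumFin k f       ≡⟨ *-comm x _ ⟩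
  sumFin k f * x       ∎
  where open ≡-Reasoning

sumFin-comm : ∀ k l (f : Fin k → Fin l → ℕ) →
  ∑[ i < k ] ∑[ j < l ] f i j ≡ ∑[ j < l ] ∑[ i < k ] f i j
sumFin-comm k l f = begin
  ∑[ i < k ] ∑[ j < l ] f i j     ≡⟨ sumFin≡sum² k l f ⟩
  sum (λ i → sum (f i))           ≡⟨ ∑-comm f ⟩
  sum (λ j → sum (λ i → f i j))   ≡⟨ sumFin≡sum² l k (λ j i → f i j) ⟨
  ∑[ j < l ] ∑[ i < k ] f i j     ∎
  where
  open ≡-Reasoning
  sumFin≡sum² : ∀ k l (g : Fin k → Fin l → ℕ) → ∑[ i < k ] sumFin l (g i) ≡ sum (λ i → sum (g i))
  sumFin≡sum² k l g = trans (sumFin-cong k (λ i → sumFin≡sum l (g i))) (sumFin≡sum k _)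

sumFin²-+ : ∀ k l (f g : Fin k → Fin l → ℕ) →
  ∑[ i < k ] ∑[ j < l ] f i j + g i j ≡ (∑[ i < k ] ∑[ j < l ] f i j) + (∑[ i < k ] ∑[ j < l ] g i j)
sumFin²-+ k l f g = trans (sumFin-cong k (λ i → sumFin-+ l (f i) (g i))) (sumFin-+ k _ _)

sumFin²-*ˡ : ∀ k l x (f : Fin k → Fin l → ℕ) →
  ∑[ i < k ] ∑[ j < l ] x * f i j ≡ x * (∑[ i < k ] ∑[ j < l ] f i j)
sumFin²-*ˡ k l x f = trans (sumFin-cong k (λ i → sumFin-*ˡ l x (f i))) (sumFin-*ˡ k x _)

sumFin-pull-*ˡ : ∀ k l (g : Fin l → ℕ) (F : Fin k → Fin l → ℕ) →
  ∑[ i < k ] ∑[ j < l ] g j * F i j ≡ ∑[ j < l ] g j * (∑[ i < k ] F i j)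
sumFin-pull-*ˡ k l g F = trans (sumFin-comm k l _) (sumFin-cong l (λ j → sumFin-*ˡ k (g j) (λ i → F i j)))

sumFin-pull-*ˡ³ : ∀ p q r s (g : Fin s → ℕ) (F : Fin p → Fin q → Fin r → Fin s → ℕ) →
  ∑[ i < p ] ∑[ j < q ] ∑[ k < r ] ∑[ l < s ] g l * F i j k l
  ≡ ∑[ l < s ] g l * (∑[ i < p ] ∑[ j < q ] ∑[ k < r ] F i j k l)
sumFin-pull-*ˡ³ p q r s g F = begin
  ∑[ i < p ] ∑[ j < q ] ∑[ k < r ] ∑[ l < s ] g l * F i j k l
    ≡⟨ sumFin-cong p (λ i → sumFin-cong q (λ j → sumFin-pull-*ˡ r s g (F i j))) ⟩
  ∑[ i < p ] ∑[ j < q ] ∑[ l < s ] g l * (∑[ k < r ] F i j k l)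
    ≡⟨ sumFin-cong p (λ i → sumFin-pull-*ˡ q s g _) ⟩
  ∑[ i < p ] ∑[ l < s ] g l * (∑[ j < q ] ∑[ k < r ] F i j k l)
    ≡⟨ sumFin-pull-*ˡ p s g _ ⟩
  ∑[ l < s ] g l * (∑[ i < p ] ∑[ j < q ] ∑[ k < r ] F i j k l) ∎
  where open ≡-Reasoning

sumFin-inside³ : ∀ p q r s (F : Fin s → Fin p → Fin q → Fin r → ℕ) →
  ∑[ l < s ] ∑[ i < p ] ∑[ j < q ] ∑[ k < r ] F l i j k
  ≡ ∑[ i < p ] ∑[ j < q ] ∑[ k < r ] ∑[ l < s ] F l i j k
sumFin-inside³ p q r s F =
  trans (sumFin-comm s p _) (sumFin-cong p (λ i →
    trans (sumFin-comm s q _) (sumFin-cong q (λ j → sumFin-comm s r _))))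

sumFin-factor-ends₄ : ∀ p q r s (g : Fin p → Fin q → Fin r → ℕ) (h : Fin r → Fin q → Fin s → ℕ) →
  ∑[ i < p ] ∑[ j < q ] ∑[ k < r ] ∑[ l < s ] g i j k * h k j l
  ≡ ∑[ j < q ] ∑[ k < r ] (∑[ i < p ] g i j k) * (∑[ l < s ] h k j l)
sumFin-factor-ends₄ p q r s g h = begin
  ∑[ i < p ] ∑[ j < q ] ∑[ k < r ] ∑[ l < s ] g i j k * h k j l
    ≡⟨ sumFin-cong p (λ i → sumFin-cong q (λ j → sumFin-cong r (λ k →
         sumFin-*ˡ s (g i j k) (h k j)))) ⟩
  ∑[ i < p ] ∑[ j < q ] ∑[ k < r ] g i j k * H k j
    ≡⟨ sumFin-comm p q _ ⟩
  ∑[ j < q ] ∑[ i < p ] ∑[ k < r ] g i j k * H k j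
    ≡⟨ sumFin-cong q (λ j → sumFin-comm p r _) ⟩
  ∑[ j < q ] ∑[ k < r ] ∑[ i < p ] g i j k * H k j
    ≡⟨ sumFin-cong q (λ j → sumFin-cong r (λ k → sumFin-*ʳ p (H k j) (λ i → g i j k))) ⟩
  ∑[ j < q ] ∑[ k < r ] (∑[ i < p ] g i j k) * H k j ∎
  where
  open ≡-Reasoning
  H : Fin r → Fin q → ℕ
  H k j = sumFin s (h k j)

sumFin-factor-ends₅ : ∀ p q r s t (u : Fin p → Fin q → Fin r → ℕ) (v : Fin q → Fin r → Fin s → ℕ)
  (w : Fin q → Fin s → Fin t → ℕ) →
  ∑[ x < p ] ∑[ z < t ] ∑[ j < q ] ∑[ i < r ] ∑[ k < s ] u x j i * (v j i k * w j k z)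
  ≡ ∑[ j < q ] ∑[ i < r ] ∑[ k < s ] (∑[ x < p ] u x j i) * (v j i k * (∑[ z < t ] w j k z))
sumFin-factor-ends₅ p q r s t u v w = begin
  ∑[ x < p ] ∑[ z < t ] ∑[ j < q ] ∑[ i < r ] ∑[ k < s ] u x j i * (v j i k * w j k z)
    ≡⟨ sumFin-cong p (λ x → sumFin-inside³ q r s t _) ⟩
  ∑[ x < p ] ∑[ j < q ] ∑[ i < r ] ∑[ k < s ] ∑[ z < t ] u x j i * (v j i k * w j k z)
    ≡⟨ sumFin-cong p (λ x → sumFin-cong q (λ j → sumFin-cong r (λ i → sumFin-cong s (λ k →
         factor-z x j i k)))) ⟩
  ∑[ x < p ] ∑[ j < q ] ∑[ i < r ] ∑[ k < s ] u x j i * (v j i k * W j k)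
    ≡⟨ sumFin-inside³ q r s p _ ⟩
  ∑[ j < q ] ∑[ i < r ] ∑[ k < s ] ∑[ x < p ] u x j i * (v j i k * W j k)
    ≡⟨ sumFin-cong q (λ j → sumFin-cong r (λ i → sumFin-cong s (λ k →
         sumFin-*ʳ p _ (λ x → u x j i)))) ⟩
  ∑[ j < q ] ∑[ i < r ] ∑[ k < s ] (∑[ x < p ] u x j i) * (v j i k * W j k) ∎
  where
  open ≡-Reasoning
  W : Fin q → Fin s → ℕ
  W j k = sumFin t (w j k)
  factor-z : ∀ x j i k → ∑[ z < t ] u x j i * (v j i k * w j k z) ≡ u x j i * (v j i k * W j k)
  factor-z x j i k = trans (sumFin-*ˡ t (u x j i) _) (cong (u x j i *_) (sumFin-*ˡ t (v j i k) (w j k)))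

2*[m*n]≤m*m+n*n : ∀ m n → 2 * (m * n) ≤ m * m + n * n
2*[m*n]≤m*m+n*n m n = [ ordered m n , flipped ]′ (≤-total m n)
  where
  ordered : ∀ m n → m ≤ n → 2 * (m * n) ≤ m * m + n * n
  ordered m n m≤n with m≤n⇒∃[o]m+o≡n m≤n
  ... | d , refl = ≤-trans (m≤m+n _ (d * d)) (≤-reflexive (square-gap m d))
    where
    square-gap : ∀ m d → 2 * (m * (m + d)) + d * d ≡ m * m + (m + d) * (m + d)
    square-gap = solve-∀
  flipped : n ≤ m → 2 * (m * n) ≤ m * m + n * n
  flipped n≤m = subst₂ _≤_ (cong (2 *_) (*-comm n m)) (+-comm (n * n) (m * m)) (ordered n m n≤m)

4*[m*n]≤[m+n]*[m+n] : ∀ m n → 4 * (m * n) ≤ (m + n) * (m + n)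
4*[m*n]≤[m+n]*[m+n] m n =
  subst₂ _≤_ (lhs m n) (rhs m n) (+-monoʳ-≤ (2 * (m * n)) (2*[m*n]≤m*m+n*n m n))
  where
  lhs : ∀ m n → 2 * (m * n) + 2 * (m * n) ≡ 4 * (m * n)
  lhs = solve-∀
  rhs : ∀ m n → 2 * (m * n) + (m * m + n * n) ≡ (m + n) * (m + n)
  rhs = solve-∀

sumFin²-weighted-amgm : ∀ α β k l (x y : Fin k → Fin l → ℕ) →
  2 * α * β * (∑[ i < k ] ∑[ j < l ] x i j * y i j)
  ≤ β * β * (∑[ i < k ] ∑[ j < l ] x i j * x i j) + α * α * (∑[ i < k ] ∑[ j < l ] y i j * y i j)
sumFin²-weighted-amgm α β k l x y = begin
  2 * α * β * (∑[ i < k ] ∑[ j < l ] x i j * y i j)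
    ≡⟨ sumFin²-*ˡ k l (2 * α * β) _ ⟨
  ∑[ i < k ] ∑[ j < l ] 2 * α * β * (x i j * y i j)
    ≤⟨ sumFin-mono-≤ k (λ i → sumFin-mono-≤ l (λ j → pointwise (x i j) (y i j))) ⟩
  ∑[ i < k ] ∑[ j < l ] β * β * (x i j * x i j) + α * α * (y i j * y i j)
    ≡⟨ sumFin²-+ k l _ _ ⟩
  (∑[ i < k ] ∑[ j < l ] β * β * (x i j * x i j)) + (∑[ i < k ] ∑[ j < l ] α * α * (y i j * y i j))
    ≡⟨ cong₂ _+_ (sumFin²-*ˡ k l (β * β) _) (sumFin²-*ˡ k l (α * α) _) ⟩
  β * β * (∑[ i < k ] ∑[ j < l ] x i j * x i j) + α * α * (∑[ i < k ] ∑[ j < l ] y i j * y i j) ∎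
  where
  open ≤-Reasoning
  pointwise : ∀ a b → 2 * α * β * (a * b) ≤ β * β * (a * a) + α * α * (b * b)
  pointwise a b = subst₂ _≤_ (lhs α β a b) (rhs α β a b) (2*[m*n]≤m*m+n*n (β * a) (α * b))
    where
    lhs : ∀ α β a b → 2 * ((β * a) * (α * b)) ≡ 2 * α * β * (a * b)
    lhs = solve-∀
    rhs : ∀ α β a b → (β * a) * (β * a) + (α * b) * (α * b) ≡ β * β * (a * a) + α * α * (b * b)
    rhs = solve-∀

[sumFin]²≤k*sumFin² : ∀ k (y : Fin k → ℕ) → sumFin k y * sumFin k y ≤ k * (∑[ i < k ] y i * y i)
[sumFin]²≤k*sumFin² k y = *-cancelˡ-≤ 2 (begin
  2 * (S * S)                                  ≡⟨ cong (2 *_) square-as-double-sum ⟩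
  2 * (∑[ i < k ] ∑[ j < k ] y i * y j)        ≡⟨ sumFin²-*ˡ k k 2 _ ⟨
  ∑[ i < k ] ∑[ j < k ] 2 * (y i * y j)        ≤⟨ sumFin-mono-≤ k (λ i → sumFin-mono-≤ k (λ j →
                                                    2*[m*n]≤m*m+n*n (y i) (y j))) ⟩
  ∑[ i < k ] ∑[ j < k ] y i * y i + y j * y j  ≡⟨ sumFin²-+ k k _ _ ⟩
  (∑[ i < k ] ∑[ _ < k ] y i * y i) + (∑[ _ < k ] Q)
                                               ≡⟨ cong₂ _+_ (sumFin-cong k (λ i → sumFin-const k _))
                                                            (sumFin-const k Q) ⟩
  (∑[ i < k ] k * (y i * y i)) + k * Q         ≡⟨ cong (_+ k * Q) (sumFin-*ˡ k k _) ⟩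
  k * Q + k * Q                                ≡⟨ cong (k * Q +_) (+-identityʳ (k * Q)) ⟨
  2 * (k * Q)                                  ∎)
  where
  open ≤-Reasoning
  S = sumFin k y
  Q = ∑[ i < k ] y i * y i
  square-as-double-sum : S * S ≡ ∑[ i < k ] ∑[ j < k ] y i * y j
  square-as-double-sum = sym (trans (sumFin-cong k (λ i → sumFin-*ˡ k (y i) y)) (sumFin-*ʳ k S y))

𝟙-mono : ∀ {P Q : Set} (p : Dec P) (q : Dec Q) → (P → Q) → 𝟙 p ≤ 𝟙 q
𝟙-mono (yes p) (yes q) P⇒Q = ≤-refl
𝟙-mono (yes p) (no ¬q) P⇒Q = contradiction (P⇒Q p) ¬q
𝟙-mono (no ¬p) q       P⇒Q = z≤n

𝟙-×-dec : ∀ {P Q : Set} (p : Dec P) (q : Dec Q) → 𝟙 (p ×-dec q) ≡ 𝟙 p * 𝟙 q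
𝟙-×-dec (yes p) (yes q) = refl
𝟙-×-dec (yes p) (no ¬q) = refl
𝟙-×-dec (no ¬p) q       = refl

𝟙+𝟙≤1 : ∀ {P Q : Set} (p : Dec P) (q : Dec Q) → (P → ¬ Q) → 𝟙 p + 𝟙 q ≤ 1
𝟙+𝟙≤1 (yes p) (yes q) P⇒¬Q = contradiction q (P⇒¬Q p)
𝟙+𝟙≤1 (yes p) (no ¬q) P⇒¬Q = ≤-refl
𝟙+𝟙≤1 (no ¬p) (yes q) P⇒¬Q = ≤-refl
𝟙+𝟙≤1 (no ¬p) (no ¬q) P⇒¬Q = z≤n

before : ∀ {n} → Fin n → Fin n → ℕ
before i j = 𝟙 (toℕ i <? toℕ j)

before+before≤1 : ∀ {n} (i j : Fin n) → before i j + before j i ≤ 1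
before+before≤1 i j = 𝟙+𝟙≤1 (toℕ i <? toℕ j) (toℕ j <? toℕ i) <-asym

2*sumFin-before≤sumFin : ∀ n (R : Fin n → Fin n → ℕ) → (∀ i j → R i j ≡ R j i) →
  2 * (∑[ i < n ] ∑[ j < n ] before i j * R i j) ≤ ∑[ i < n ] ∑[ j < n ] R i j
2*sumFin-before≤sumFin n R R-sym = begin
  2 * upper                                                ≡⟨ cong (upper +_) (+-identityʳ upper) ⟩
  upper + upper                                            ≡⟨ cong (upper +_) upper≡lower ⟩
  upper + (∑[ i < n ] ∑[ j < n ] before j i * R i j)       ≡⟨ sumFin²-+ n n _ _ ⟨
  ∑[ i < n ] ∑[ j < n ] before i j * R i j + before j i * R i j
                                                           ≤⟨ sumFin-mono-≤ n (λ i → sumFin-mono-≤ n (λ j →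
                                                                at-most-once i j)) ⟩
  ∑[ i < n ] ∑[ j < n ] R i j                              ∎
  where
  open ≤-Reasoning
  upper = ∑[ i < n ] ∑[ j < n ] before i j * R i j
  upper≡lower : upper ≡ ∑[ i < n ] ∑[ j < n ] before j i * R i j
  upper≡lower = trans (sumFin-comm n n _)
    (sumFin-cong n (λ i → sumFin-cong n (λ j → cong (before j i *_) (R-sym j i))))
  at-most-once : ∀ i j → before i j * R i j + before j i * R i j ≤ R i j
  at-most-once i j = begin
    before i j * R i j + before j i * R i j  ≡⟨ *-distribʳ-+ (R i j) (before i j) (before j i) ⟨
    (before i j + before j i) * R i j        ≤⟨ *-monoˡ-≤ (R i j) (before+before≤1 i j) ⟩
    1 * R i j                                ≡⟨ *-identityˡ (R i j) ⟩
    R i j                                    ∎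

differ : Bool → Bool → ℕ
differ x y = 𝟙 (¬? (x B.≟ y))

differ-sym : ∀ x y → differ x y ≡ differ y x
differ-sym false false = refl
differ-sym false true  = refl
differ-sym true  false = refl
differ-sym true  true  = refl

differ-+-not : ∀ x z → differ x z + differ (not x) z ≡ 1
differ-+-not false false = refl
differ-+-not false true  = refl
differ-+-not true  false = refl
differ-+-not true  true  = refl

module TwoColouring {k : ℕ} (f : Fin k → Bool) where

  opposite : (Fin k → ℕ) → Bool → ℕ
  opposite y x = ∑[ j < k ] differ x (f j) * y j

  opposite-+-not : ∀ y x → opposite y x + opposite y (not x) ≡ sumFin k y
  opposite-+-not y x = begin
    opposite y x + opposite y (not x)                             ≡⟨ sumFin-+ k _ _ ⟨
    ∑[ j < k ] differ x (f j) * y j + differ (not x) (f j) * y j  ≡⟨ sumFin-cong k split ⟩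
    sumFin k y                                                    ∎
    where
    open ≡-Reasoning
    split : ∀ j → differ x (f j) * y j + differ (not x) (f j) * y j ≡ y j
    split j = begin
      differ x (f j) * y j + differ (not x) (f j) * y j  ≡⟨ *-distribʳ-+ (y j) (differ x (f j)) _ ⟨
      (differ x (f j) + differ (not x) (f j)) * y j      ≡⟨ cong (_* y j) (differ-+-not x (f j)) ⟩
      1 * y j                                            ≡⟨ *-identityˡ (y j) ⟩
      y j                                                ∎

  sumFin-by-colour : ∀ y (h : Bool → ℕ) →
    ∑[ i < k ] y i * h (f i) ≡ opposite y false * h true + opposite y true * h false
  sumFin-by-colour y h = begin
    ∑[ i < k ] y i * h (f i)
      ≡⟨ sumFin-cong k (λ i → split (f i) (y i)) ⟩
    ∑[ i < k ] differ false (f i) * y i * h true + differ true (f i) * y i * h false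
      ≡⟨ sumFin-+ k _ _ ⟩
    (∑[ i < k ] differ false (f i) * y i * h true) + (∑[ i < k ] differ true (f i) * y i * h false)
      ≡⟨ cong₂ _+_ (sumFin-*ʳ k _ _) (sumFin-*ʳ k _ _) ⟩
    opposite y false * h true + opposite y true * h false ∎
    where
    open ≡-Reasoning
    split : ∀ z w → w * h z ≡ differ false z * w * h true + differ true z * w * h false
    split false w = on-false w (h true) (h false)
      where
      on-false : ∀ w a b → w * b ≡ 0 * w * a + 1 * w * b
      on-false = solve-∀
    split true  w = on-true w (h true) (h false)
      where
      on-true : ∀ w a b → w * a ≡ 1 * w * a + 0 * w * b
      on-true = solve-∀

  4*sumFin-opposite²≤k³ : 4 * (∑[ i < k ] opposite (const 1) (f i) * opposite (const 1) (f i)) ≤ k * (k * k)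
  4*sumFin-opposite²≤k³ = begin
    4 * (∑[ i < k ] square (f i))       ≡⟨ cong (4 *_) (sumFin-cong k (λ i → *-identityˡ _)) ⟨
    4 * (∑[ i < k ] 1 * square (f i))   ≡⟨ cong (4 *_) (sumFin-by-colour (const 1) square) ⟩
    4 * (T * (F * F) + F * (T * T))     ≡⟨ factor T F ⟩
    4 * (T * F) * (T + F)               ≤⟨ *-monoˡ-≤ (T + F) (4*[m*n]≤[m+n]*[m+n] T F) ⟩
    (T + F) * (T + F) * (T + F)         ≡⟨ cong (λ s → s * s * s) T+F≡k ⟩
    k * k * k                           ≡⟨ *-assoc k k k ⟩
    k * (k * k)                         ∎
    where
    open ≤-Reasoning
    square : Bool → ℕ
    square x = opposite (const 1) x * opposite (const 1) x
    T = opposite (const 1) false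
    F = opposite (const 1) true
    T+F≡k : T + F ≡ k
    T+F≡k = trans (opposite-+-not (const 1) false) (trans (sumFin-const k 1) (*-identityʳ k))
    factor : ∀ T F → 4 * (T * (F * F) + F * (T * T)) ≡ 4 * (T * F) * (T + F)
    factor = solve-∀

  2*sumFin-cross≤[sumFin]² : ∀ y →
    2 * (∑[ i < k ] ∑[ j < k ] y i * (differ (f i) (f j) * y j)) ≤ sumFin k y * sumFin k y
  2*sumFin-cross≤[sumFin]² y = begin
    2 * (∑[ i < k ] ∑[ j < k ] y i * (differ (f i) (f j) * y j))
                                    ≡⟨ cong (2 *_) (sumFin-cong k (λ i → sumFin-*ˡ k (y i) _)) ⟩
    2 * (∑[ i < k ] y i * opposite y (f i))
                                    ≡⟨ cong (2 *_) (sumFin-by-colour y (opposite y)) ⟩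
    2 * (P * N + N * P)             ≡⟨ double P N ⟩
    4 * (P * N)                     ≤⟨ 4*[m*n]≤[m+n]*[m+n] P N ⟩
    (P + N) * (P + N)               ≡⟨ cong (λ s → s * s) (opposite-+-not y false) ⟩
    sumFin k y * sumFin k y         ∎
    where
    open ≤-Reasoning
    P = opposite y false
    N = opposite y true
    double : ∀ P N → 2 * (P * N + N * P) ≡ 4 * (P * N)
    double = solve-∀

module AlternatingPaths {m n : ℕ} (c : Coloring m n) where
  open TwoColouring using (opposite; 4*sumFin-opposite²≤k³; 2*sumFin-cross≤[sumFin]²)

  oppositeAtA oppositeAtB : Fin m → Fin n → ℕ
  oppositeAtA a b = opposite (c a) (const 1) (c a b)
  oppositeAtB a b = opposite (flip c b) (const 1) (c a b)

  sumFin-differ≡oppositeAtA : ∀ a b → ∑[ b′ < n ] differ (c a b′) (c a b) ≡ oppositeAtA a b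
  sumFin-differ≡oppositeAtA a b =
    sumFin-cong n (λ b′ → trans (differ-sym (c a b′) (c a b)) (sym (*-identityʳ _)))

  sumFin-differ≡oppositeAtB : ∀ a b → ∑[ a′ < m ] differ (c a′ b) (c a b) ≡ oppositeAtB a b
  sumFin-differ≡oppositeAtB a b =
    sumFin-cong m (λ a′ → trans (differ-sym (c a′ b) (c a b)) (sym (*-identityʳ _)))

  4*sumFin-oppositeAtA²≤mn³ :
    4 * (∑[ b < n ] ∑[ a < m ] oppositeAtA a b * oppositeAtA a b) ≤ m * (n * (n * n))
  4*sumFin-oppositeAtA²≤mn³ = begin
    4 * (∑[ b < n ] ∑[ a < m ] oppositeAtA a b * oppositeAtA a b)  ≡⟨ cong (4 *_) (sumFin-comm n m _) ⟩
    4 * (∑[ a < m ] ∑[ b < n ] oppositeAtA a b * oppositeAtA a b)  ≡⟨ sumFin-*ˡ m 4 _ ⟨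
    ∑[ a < m ] 4 * (∑[ b < n ] oppositeAtA a b * oppositeAtA a b)  ≤⟨ sumFin-≤-const m (λ a →
                                                                        4*sumFin-opposite²≤k³ (c a)) ⟩
    m * (n * (n * n))                                              ∎
    where open ≤-Reasoning

  4*sumFin-oppositeAtB²≤nm³ :
    4 * (∑[ b < n ] ∑[ a < m ] oppositeAtB a b * oppositeAtB a b) ≤ n * (m * (m * m))
  4*sumFin-oppositeAtB²≤nm³ = begin
    4 * (∑[ b < n ] ∑[ a < m ] oppositeAtB a b * oppositeAtB a b)  ≡⟨ sumFin-*ˡ n 4 _ ⟨
    ∑[ b < n ] 4 * (∑[ a < m ] oppositeAtB a b * oppositeAtB a b)  ≤⟨ sumFin-≤-const n (λ b →
                                                                        4*sumFin-opposite²≤k³ (flip c b)) ⟩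
    n * (m * (m * m))                                              ∎
    where open ≤-Reasoning

  numAlt3≤sumFin-oppositeAtB*oppositeAtA :
    numAlt3 c ≤ ∑[ b < n ] ∑[ a < m ] oppositeAtB a b * oppositeAtA a b
  numAlt3≤sumFin-oppositeAtB*oppositeAtA = begin
    numAlt3 c
      ≤⟨ sumFin-mono-≤ m (λ a₁ → sumFin-mono-≤ n (λ b₁ → sumFin-mono-≤ m (λ a₂ →
           sumFin-mono-≤ n (λ b₂ → path≤walk a₁ b₁ a₂ b₂)))) ⟩
    ∑[ a₁ < m ] ∑[ b₁ < n ] ∑[ a₂ < m ] ∑[ b₂ < n ]
      differ (c a₁ b₁) (c a₂ b₁) * differ (c a₂ b₁) (c a₂ b₂)
      ≡⟨ sumFin-factor-ends₄ m n m n (λ a₁ b a → differ (c a₁ b) (c a b))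
                                     (λ a b b₂ → differ (c a b) (c a b₂)) ⟩
    ∑[ b < n ] ∑[ a < m ]
      (∑[ a₁ < m ] differ (c a₁ b) (c a b)) * (∑[ b₂ < n ] differ (c a b) (c a b₂))
      ≡⟨ sumFin-cong n (λ b → sumFin-cong m (λ a →
           cong₂ _*_ (sumFin-differ≡oppositeAtB a b) (sumFin-cong n (λ b₂ → sym (*-identityʳ _))))) ⟩
    ∑[ b < n ] ∑[ a < m ] oppositeAtB a b * oppositeAtA a b ∎
    where
    open ≤-Reasoning
    path≤walk : ∀ a₁ b₁ a₂ b₂ →
      𝟙 (altPath3? c a₁ b₁ a₂ b₂) ≤ differ (c a₁ b₁) (c a₂ b₁) * differ (c a₂ b₁) (c a₂ b₂)
    path≤walk a₁ b₁ a₂ b₂ = begin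
      𝟙 (altPath3? c a₁ b₁ a₂ b₂)  ≤⟨ 𝟙-mono (altPath3? c a₁ b₁ a₂ b₂) (e₁ ×-dec e₂)
                                              (λ (_ , _ , alt) → alt) ⟩
      𝟙 (e₁ ×-dec e₂)              ≡⟨ 𝟙-×-dec e₁ e₂ ⟩
      𝟙 e₁ * 𝟙 e₂                  ∎
      where
      e₁ = ¬? (c a₁ b₁ B.≟ c a₂ b₁)
      e₂ = ¬? (c a₂ b₁ B.≟ c a₂ b₂)

  4*numAlt3≤m²n² : .{{_ : NonZero m}} .{{_ : NonZero n}} → 4 * numAlt3 c ≤ m ^ 2 * n ^ 2
  4*numAlt3≤m²n² = ≤-trans (*-monoʳ-≤ 4 numAlt3≤sumFin-oppositeAtB*oppositeAtA)
    (*-cancelˡ-≤ (2 * m * n) {{m*n≢0 (2 * m) n {{m*n≢0 2 m}}}} (begin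
      2 * m * n * (4 * XY)
        ≡⟨ regroup₁ m n XY ⟩
      4 * (2 * m * n * XY)
        ≤⟨ *-monoʳ-≤ 4 (sumFin²-weighted-amgm m n n m (flip oppositeAtB) (flip oppositeAtA)) ⟩
      4 * (n * n * XX + m * m * YY)
        ≡⟨ regroup₂ m n XX YY ⟩
      n * n * (4 * XX) + m * m * (4 * YY)
        ≤⟨ +-mono-≤ (*-monoʳ-≤ (n * n) 4*sumFin-oppositeAtB²≤nm³)
                    (*-monoʳ-≤ (m * m) 4*sumFin-oppositeAtA²≤mn³) ⟩
      n * n * (n * (m * (m * m))) + m * m * (m * (n * (n * n)))
        ≡⟨ regroup₃ m n ⟩
      2 * m * n * (m ^ 2 * n ^ 2) ∎))
    where
    open ≤-Reasoning
    XY = ∑[ b < n ] ∑[ a < m ] oppositeAtB a b * oppositeAtA a b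
    XX = ∑[ b < n ] ∑[ a < m ] oppositeAtB a b * oppositeAtB a b
    YY = ∑[ b < n ] ∑[ a < m ] oppositeAtA a b * oppositeAtA a b
    regroup₁ : ∀ m n s → 2 * m * n * (4 * s) ≡ 4 * (2 * m * n * s)
    regroup₁ = solve-∀
    regroup₂ : ∀ m n s t → 4 * (n * n * s + m * m * t) ≡ n * n * (4 * s) + m * m * (4 * t)
    regroup₂ = solve-∀
    regroup₃ : ∀ m n → n * n * (n * (m * (m * m))) + m * m * (m * (n * (n * n)))
                     ≡ 2 * m * n * (m * (m * 1) * (n * (n * 1)))
    regroup₃ = solve-∀

  alternating₄ : Fin n → Fin m → Fin n → Fin m → Fin n → ℕ
  alternating₄ b₁ a₁ b₂ a₂ b₃ =
    differ (c a₁ b₁) (c a₁ b₂) * (differ (c a₁ b₂) (c a₂ b₂) * differ (c a₂ b₂) (c a₂ b₃))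

  alternating₄-reverse : ∀ b₁ a₁ b₂ a₂ b₃ →
    alternating₄ b₃ a₂ b₂ a₁ b₁ ≡ alternating₄ b₁ a₁ b₂ a₂ b₃
  alternating₄-reverse b₁ a₁ b₂ a₂ b₃ = begin
    differ (c a₂ b₃) (c a₂ b₂) * (differ (c a₂ b₂) (c a₁ b₂) * differ (c a₁ b₂) (c a₁ b₁))
      ≡⟨ cong₂ _*_ (differ-sym (c a₂ b₃) (c a₂ b₂))
                   (cong₂ _*_ (differ-sym (c a₂ b₂) (c a₁ b₂)) (differ-sym (c a₁ b₂) (c a₁ b₁))) ⟩
    d₃ * (d₂ * d₁)
      ≡⟨ x∙yz≈z∙yx d₃ d₂ d₁ ⟩
    d₁ * (d₂ * d₃) ∎
    where
    open ≡-Reasoning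
    d₁ = differ (c a₁ b₁) (c a₁ b₂)
    d₂ = differ (c a₁ b₂) (c a₂ b₂)
    d₃ = differ (c a₂ b₂) (c a₂ b₃)

  alternatingWalks₄ : Fin n → Fin n → ℕ
  alternatingWalks₄ b₁ b₃ = ∑[ b₂ < n ] ∑[ a₁ < m ] ∑[ a₂ < m ] alternating₄ b₁ a₁ b₂ a₂ b₃

  alternatingWalks₄-sym : ∀ b₁ b₃ → alternatingWalks₄ b₁ b₃ ≡ alternatingWalks₄ b₃ b₁
  alternatingWalks₄-sym b₁ b₃ = sumFin-cong n (λ b₂ → trans
    (sumFin-cong m (λ a₁ → sumFin-cong m (λ a₂ → sym (alternating₄-reverse b₁ a₁ b₂ a₂ b₃))))
    (sumFin-comm m m _))

  numAlt4B≤sumFin-before*alternatingWalks₄ :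
    numAlt4B c ≤ ∑[ b₁ < n ] ∑[ b₃ < n ] before b₁ b₃ * alternatingWalks₄ b₁ b₃
  numAlt4B≤sumFin-before*alternatingWalks₄ = begin
    numAlt4B c
      ≤⟨ sumFin-mono-≤ n (λ b₁ → sumFin-mono-≤ m (λ a₁ → sumFin-mono-≤ n (λ b₂ →
           sumFin-mono-≤ m (λ a₂ → sumFin-mono-≤ n (λ b₃ → path≤ordered-walk b₁ a₁ b₂ a₂ b₃))))) ⟩
    ∑[ b₁ < n ] ∑[ a₁ < m ] ∑[ b₂ < n ] ∑[ a₂ < m ] ∑[ b₃ < n ]
      before b₁ b₃ * alternating₄ b₁ a₁ b₂ a₂ b₃
      ≡⟨ sumFin-cong n (λ b₁ → sumFin-pull-*ˡ³ m n m n (before b₁) (alternating₄ b₁)) ⟩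
    ∑[ b₁ < n ] ∑[ b₃ < n ]
      before b₁ b₃ * (∑[ a₁ < m ] ∑[ b₂ < n ] ∑[ a₂ < m ] alternating₄ b₁ a₁ b₂ a₂ b₃)
      ≡⟨ sumFin-cong n (λ b₁ → sumFin-cong n (λ b₃ → cong (before b₁ b₃ *_) (sumFin-comm m n _))) ⟩
    ∑[ b₁ < n ] ∑[ b₃ < n ] before b₁ b₃ * alternatingWalks₄ b₁ b₃ ∎
    where
    open ≤-Reasoning
    path≤ordered-walk : ∀ b₁ a₁ b₂ a₂ b₃ →
      𝟙 (altPath4? c b₁ a₁ b₂ a₂ b₃) ≤ before b₁ b₃ * alternating₄ b₁ a₁ b₂ a₂ b₃
    path≤ordered-walk b₁ a₁ b₂ a₂ b₃ = begin
      𝟙 (altPath4? c b₁ a₁ b₂ a₂ b₃)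
        ≤⟨ 𝟙-mono (altPath4? c b₁ a₁ b₂ a₂ b₃) (lt ×-dec e₁ ×-dec e₂ ×-dec e₃)
                  (λ (b₁<b₃ , _ , _ , _ , alt) → b₁<b₃ , alt) ⟩
      𝟙 (lt ×-dec e₁ ×-dec e₂ ×-dec e₃)
        ≡⟨ 𝟙-×-dec lt (e₁ ×-dec e₂ ×-dec e₃) ⟩
      𝟙 lt * 𝟙 (e₁ ×-dec e₂ ×-dec e₃)
        ≡⟨ cong (𝟙 lt *_) (𝟙-×-dec e₁ (e₂ ×-dec e₃)) ⟩
      𝟙 lt * (𝟙 e₁ * 𝟙 (e₂ ×-dec e₃))
        ≡⟨ cong (λ d → 𝟙 lt * (𝟙 e₁ * d)) (𝟙-×-dec e₂ e₃) ⟩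
      𝟙 lt * (𝟙 e₁ * (𝟙 e₂ * 𝟙 e₃)) ∎
      where
      lt = toℕ b₁ <? toℕ b₃
      e₁ = ¬? (c a₁ b₁ B.≟ c a₁ b₂)
      e₂ = ¬? (c a₁ b₂ B.≟ c a₂ b₂)
      e₃ = ¬? (c a₂ b₂ B.≟ c a₂ b₃)

  sumFin-alternatingWalks₄ :
    ∑[ b₁ < n ] ∑[ b₃ < n ] alternatingWalks₄ b₁ b₃
    ≡ ∑[ b₂ < n ] ∑[ a₁ < m ] ∑[ a₂ < m ]
        oppositeAtA a₁ b₂ * (differ (c a₁ b₂) (c a₂ b₂) * oppositeAtA a₂ b₂)
  sumFin-alternatingWalks₄ = trans
    (sumFin-factor-ends₅ n n m m n (λ b₁ b₂ a₁ → differ (c a₁ b₁) (c a₁ b₂))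
      (λ b₂ a₁ a₂ → differ (c a₁ b₂) (c a₂ b₂))
      (λ b₂ a₂ b₃ → differ (c a₂ b₂) (c a₂ b₃)))
    (sumFin-cong n (λ b₂ → sumFin-cong m (λ a₁ → sumFin-cong m (λ a₂ →
      cong₂ _*_ (sumFin-differ≡oppositeAtA a₁ b₂)
                (cong (differ (c a₁ b₂) (c a₂ b₂) *_) (sumFin-cong n (λ b₃ → sym (*-identityʳ _))))))))

  16*numAlt4B≤m²n³ : 16 * numAlt4B c ≤ m ^ 2 * n ^ 3
  16*numAlt4B≤m²n³ = begin
    16 * numAlt4B c
      ≤⟨ *-monoʳ-≤ 16 numAlt4B≤sumFin-before*alternatingWalks₄ ⟩
    16 * upper                                  ≡⟨ *-assoc 8 2 upper ⟩
    8 * (2 * upper)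
      ≤⟨ *-monoʳ-≤ 8 (2*sumFin-before≤sumFin n alternatingWalks₄ alternatingWalks₄-sym) ⟩
    8 * (∑[ b₁ < n ] ∑[ b₃ < n ] alternatingWalks₄ b₁ b₃)
      ≡⟨ cong (8 *_) sumFin-alternatingWalks₄ ⟩
    8 * sumFin n cross                          ≡⟨ *-assoc 4 2 (sumFin n cross) ⟩
    4 * (2 * sumFin n cross)                    ≡⟨ cong (4 *_) (sumFin-*ˡ n 2 cross) ⟨
    4 * (∑[ b < n ] 2 * cross b)
      ≤⟨ *-monoʳ-≤ 4 (sumFin-mono-≤ n (λ b → 2*sumFin-cross≤[sumFin]² (flip c b) (flip oppositeAtA b))) ⟩
    4 * (∑[ b < n ] column b * column b)
      ≤⟨ *-monoʳ-≤ 4 (sumFin-mono-≤ n (λ b → [sumFin]²≤k*sumFin² m (λ a → oppositeAtA a b))) ⟩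
    4 * (∑[ b < n ] m * (∑[ a < m ] oppositeAtA a b * oppositeAtA a b))
      ≡⟨ cong (4 *_) (sumFin-*ˡ n m _) ⟩
    4 * (m * YY)                                ≡⟨ x∙yz≈y∙xz 4 m YY ⟩
    m * (4 * YY)                                ≤⟨ *-monoʳ-≤ m 4*sumFin-oppositeAtA²≤mn³ ⟩
    m * (m * (n * (n * n)))                     ≡⟨ as-powers m n ⟩
    m ^ 2 * n ^ 3                               ∎
    where
    open ≤-Reasoning
    upper = ∑[ b₁ < n ] ∑[ b₃ < n ] before b₁ b₃ * alternatingWalks₄ b₁ b₃
    cross : Fin n → ℕ
    cross b = ∑[ a₁ < m ] ∑[ a₂ < m ] oppositeAtA a₁ b * (differ (c a₁ b) (c a₂ b) * oppositeAtA a₂ b)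
    column : Fin n → ℕ
    column b = ∑[ a < m ] oppositeAtA a b
    YY = ∑[ b < n ] ∑[ a < m ] oppositeAtA a b * oppositeAtA a b
    as-powers : ∀ m n → m * (m * (n * (n * n))) ≡ m * (m * 1) * (n * (n * (n * 1)))
    as-powers = solve-∀

lemma4p3 : (m n : ℕ) → 1 ≤ m → m ≤ n → (c : Coloring m n) →
    (4 * numAlt3 c ≤ m ^ 2 * n ^ 2) × (16 * numAlt4B c ≤ m ^ 2 * n ^ 3)
lemma4p3 m n 1≤m m≤n c =
  4*numAlt3≤m²n² {{>-nonZero 1≤m}} {{>-nonZero (≤-trans 1≤m m≤n)}} , 16*numAlt4B≤m²n³
  where open AlternatingPaths c
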